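{- Let $G$ be a finite simple graph with $\delta(G)\geq 3$ that contains neither $C_4$ nor $C_8$ as a subgraph, and let $C=x_1x_2\cdots x_mx_1$ be a good hole in $G$. Then for each $i\in[1,m]$ there exists a good path for $(C,X_i)$ with order $\min\{\lfloor m/2\rfloor-1,\,2\}$, where $X_i=\{x_i,x_{i+1}\}$ if $x_i\in I_C$; $X_i=\{x_{i-1},x_i\}$ if $x_i\in I_C^+\setminus I_C$; and $X_i=\{x_i\}$ if $x_i\notin I_C\cup I_C^+$ (indices modulo $m$).
   Context: A hole is an induced cycle; $\ell(C)$ is the length of a cycle $C$. For a cycle $C=x_1\cdots x_mx_1$ and $i\in[1,m]$, let $A_i=N(x_i)\setminus V(C)$; let $I_C=\{x_i: A_i\cap A_{i+1}\neq\emptyset\}$ and $I_C^+=\{x_i: x_{i-1}\in I_C\}$, indices modulo $m$. A hole $C$ of length at least $5$ is good if (1) there is no hole $C'$ in $G$ with $5\leq \ell(C')<\ell(C)$, and (2) subject to (1), $|I_C|$ is as large as possible (i.e., among all holes of length at least $5$ of minimum possible length, $C$ maximizes $|I_C|$). For a subgraph $H$ of $G$ and $X\subseteq V(H)$, a good path for $(H,X)$ is an induced path $P=u_1\cdots u_t$ of $G-V(H)$ such that the set of edges of $G$ between $V(P)$ and $V(H)$ is exactly $\{u_1x: x\in X\}$; its order is $t$, the number of its vertices. $C_k$ denotes a cycle on $k$ vertices. -}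

module Defs where

open import Data.Nat using (ℕ; zero; suc; _+_; _≤_; _<_; _∸_; _⊓_; ⌊_/2⌋)
open import Data.Nat.DivMod using (_%_; m%n<n)
open import Data.Bool using (Bool; true; false; T; not; _∧_; if_then_else_)
open import Data.Fin using (Fin; toℕ; fromℕ<)
open import Data.List using (List; length; filterᵇ)
open import Data.Bool.ListAction using (any)
open import Data.List using () renaming (allFin to allFinL)
open import Data.Product using (Σ; _×_)
open import Data.Sum using (_⊎_)
open import Relation.Nullary using (¬_)
open import Relation.Binary.PropositionalEquality using (_≡_; _≢_)
open import Function.Bundles using (_⇔_)
import Data.Nat as ℕ

record Graph (n : ℕ) : Set where
  field
    adj    : Fin n → Fin n → Bool
    sym    : ∀ u v → adj u v ≡ adj v u
    irrefl : ∀ v → adj v v ≡ false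
open Graph public

Adj : ∀ {n} → Graph n → Fin n → Fin n → Set
Adj G u v = T (adj G u v)

_==_ : ∀ {n} → Fin n → Fin n → Bool
a == b = toℕ a ℕ.≡ᵇ toℕ b

countᵇ : ∀ {k} → (Fin k → Bool) → ℕ
countᵇ {k} p = length (filterᵇ p (allFinL k))

deg : ∀ {n} → Graph n → Fin n → ℕ
deg G v = countᵇ (adj G v)

nxt : ∀ {m} → Fin m → Fin m
nxt {suc k} i = fromℕ< (m%n<n (suc (toℕ i)) (suc k))

prv : ∀ {m} → Fin m → Fin m
prv {suc k} i = fromℕ< (m%n<n (toℕ i + k) (suc k))

InjectiveF : ∀ {a b} → (Fin a → Fin b) → Set
InjectiveF f = ∀ i j → f i ≡ f j → i ≡ j

ContainsCycle : ∀ {n} → Graph n → ℕ → Set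
ContainsCycle {n} G k =
  Σ (Fin k → Fin n) λ f → InjectiveF f × (∀ i → Adj G (f i) (f (nxt i)))

-- c : Fin m → Fin n describes the hole x_1 x_2 ... x_m x_1 (x_{i+1} = c i):
-- an induced cycle of length m ≥ 3.
Hole : ∀ {n} → Graph n → (m : ℕ) → (Fin m → Fin n) → Set
Hole G m c =
  3 ≤ m × InjectiveF c ×
  (∀ i j → Adj G (c i) (c j) ⇔ (j ≡ nxt i ⊎ i ≡ nxt j))

onCᵇ : ∀ {n m} → (Fin m → Fin n) → Fin n → Bool
onCᵇ {m = m} c v = any (λ j → c j == v) (allFinL m)

-- x_i ∈ I_C  iff  A_i ∩ A_{i+1} ≠ ∅, where A_i = N(x_i) \ V(C)
inIᵇ : ∀ {n m} → Graph n → (Fin m → Fin n) → Fin m → Bool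
inIᵇ {n} G c i =
  any (λ v → not (onCᵇ c v) ∧ adj G v (c i) ∧ adj G v (c (nxt i))) (allFinL n)

sizeI : ∀ {n m} → Graph n → (Fin m → Fin n) → ℕ
sizeI G c = countᵇ (inIᵇ G c)

GoodHole : ∀ {n} → Graph n → (m : ℕ) → (Fin m → Fin n) → Set
GoodHole {n} G m c =
  Hole G m c × 5 ≤ m ×
  (∀ m' (c' : Fin m' → Fin n) → Hole G m' c' → 5 ≤ m' → ¬ (m' < m)) ×
  (∀ (c' : Fin m → Fin n) → Hole G m c' → sizeI G c' ≤ sizeI G c)

-- index j belongs to X_i (i.e. x_j ∈ X_i); note x_i ∈ I_C^+ iff x_{i-1} ∈ I_C
InX : ∀ {n m} → Graph n → (Fin m → Fin n) → Fin m → Fin m → Set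
InX G c i j =
  if inIᵇ G c i then (j ≡ i ⊎ j ≡ nxt i)
  else (if inIᵇ G c (prv i) then (j ≡ prv i ⊎ j ≡ i) else j ≡ i)

GoodPath : ∀ {n m} → Graph n → (Fin m → Fin n) → (Fin m → Set) →
           (t : ℕ) → (Fin t → Fin n) → Set
GoodPath G c X t u =
  InjectiveF u ×
  (∀ a i → u a ≢ c i) ×
  (∀ a b → Adj G (u a) (u b) ⇔ (toℕ b ≡ suc (toℕ a) ⊎ toℕ a ≡ suc (toℕ b))) ×
  (∀ a i → Adj G (u a) (c i) ⇔ (toℕ a ≡ 0 × X i))

order : ℕ → ℕ
order m = (⌊ m /2⌋ ∸ 1) ⊓ 2

module Submission where

-- An outside vertex adjacent to a hole vertex x_s has no other hole neighbours than x_{s-1} and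
-- x_{s+1}, and not both of them: a neighbour two steps away gives a C₄, and a farther one closes,
-- with the arc of C back to the previous neighbour, a hole of length in [5, ℓ(C)). So a common
-- outside neighbour of x_i x_{i+1} (or of x_{i-1} x_i), or else any outside neighbour of x_i, is
-- attached to C exactly at X_i, and is a good path of order 1.
-- For ℓ(C) ≥ 6 take a further outside neighbour w of that vertex y. If w had hole neighbours, the
-- first and the last of them would close, through the edge yw, holes of lengths a + 3 and b + 3
-- with a + b ≤ ℓ(C), both at least ℓ(C); hence ℓ(C) = 6 and w is adjacent to the antipode only.
-- When y is attached at x_i alone, degree ≥ 3 leaves two candidates for w, and C₄-freeness
-- together with the absence of 5-holes rules out that both fail.

open import Defs hiding (sym)
open import Data.Bool using (Bool; true; false; T; not; if_then_else_)
open import Data.Bool.ListAction using (any)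
open import Data.Bool.Properties using (T-∧)
open import Data.Empty using (⊥; ⊥-elim)
open import Data.Fin as Fin using (Fin; toℕ; fromℕ<) renaming (zero to fz; suc to fs)
open import Data.Fin.Properties using (toℕ-injective; toℕ-fromℕ<; toℕ<n; all?; any?)
open import Data.List using ([]; _∷_; length; filterᵇ; allFin)
open import Data.List.Membership.Propositional using (_∈_)
open import Data.List.Membership.Propositional.Properties using (∈-filter⁻)
open import Data.List.Relation.Unary.All using (_∷_)
open import Data.List.Relation.Unary.AllPairs using (_∷_)
open import Data.List.Relation.Unary.Any using (here; there)
open import Data.List.Relation.Unary.Any.Properties using (any⁺; any⁻; tabulate⁺; tabulate⁻)
open import Data.List.Relation.Unary.Unique.Propositional using (Unique)
import Data.List.Relation.Unary.Unique.Propositional.Properties as Unique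
open import Data.Nat as ℕ using (ℕ; zero; suc; _+_; _∸_; _≤_; _<_; z≤n; s≤s; s≤s⁻¹; ⌊_/2⌋)
open import Data.Nat.DivMod
open import Data.Nat.Induction using (<-rec)
open import Data.Nat.Properties
open import Data.Product using (Σ; ∃-syntax; _×_; _,_; proj₁; proj₂)
open import Data.Sum using (_⊎_; inj₁; inj₂)
open import Function using (_∘_; id)
open import Function.Bundles using (_⇔_; mk⇔; Equivalence)
open import Function.Properties.Equivalence using () renaming (trans to ⇔-trans)
open import Relation.Binary.Definitions using (DecidableEquality)
open import Relation.Binary.PropositionalEquality
open import Relation.Nullary using (¬_; Dec; yes; no)
open import Relation.Nullary.Decidable using (T?; toWitness; _⊎-dec_; _×-dec_)

open Equivalence using (to; from)

Adj-sym : ∀ {n} (G : Graph n) {u v} → Adj G u v → Adj G v u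
Adj-sym G {u} {v} = subst T (Graph.sym G u v)

Adj-irrefl : ∀ {n} (G : Graph n) {v} → ¬ Adj G v v
Adj-irrefl G {v} = subst T (irrefl G v)

Adj⇒≢ : ∀ {n} (G : Graph n) {u v} → Adj G u v → u ≢ v
Adj⇒≢ G uv refl = Adj-irrefl G uv

Adj? : ∀ {n} (G : Graph n) u v → Dec (Adj G u v)
Adj? G u v = T? (adj G u v)

T-not⁺ : ∀ {b} → ¬ T b → T (not b)
T-not⁺ {false} _ = _
T-not⁺ {true} ¬t = ¬t _

T-not⁻ : ∀ {b} → T (not b) → ¬ T b
T-not⁻ {false} _ ()

if-true : ∀ {b} {A B : Set} → T b → A ⇔ (if b then A else B)
if-true {true} _ = mk⇔ id id

if-false : ∀ {b} {A B : Set} → ¬ T b → B ⇔ (if b then A else B)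
if-false {false} _ = mk⇔ id id
if-false {true} ¬t = ⊥-elim (¬t _)

module _ {n : ℕ} (p : Fin n → Bool) where

  any-allFin⁻ : T (any p (allFin n)) → ∃[ i ] T (p i)
  any-allFin⁻ t = tabulate⁻ (any⁻ p _ t)

  any-allFin⁺ : ∀ i → T (p i) → T (any p (allFin n))
  any-allFin⁺ i t = any⁺ p (tabulate⁺ i t)

==⇒≡ : ∀ {n} {a b : Fin n} → T (a == b) → a ≡ b
==⇒≡ {a = a} {b} t = toℕ-injective (≡ᵇ⇒≡ (toℕ a) (toℕ b) t)

≡⇒== : ∀ {n} {a b : Fin n} → a ≡ b → T (a == b)
≡⇒== {a = a} refl = ≡⇒≡ᵇ (toℕ a) (toℕ a) refl

module _ {A : Set} (_≟ᴬ_ : DecidableEquality A) (a b : A) where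

  Avoids : A → Set
  Avoids y = y ≢ a × y ≢ b

  avoids? : ∀ y → Avoids y ⊎ (y ≡ a ⊎ y ≡ b)
  avoids? y with y ≟ᴬ a | y ≟ᴬ b
  ... | yes y≡a | _       = inj₂ (inj₁ y≡a)
  ... | no _    | yes y≡b = inj₂ (inj₂ y≡b)
  ... | no y≢a  | no y≢b  = inj₁ (y≢a , y≢b)

  one-of-three-avoids : ∀ {x y z} → x ≢ y → x ≢ z → y ≢ z → ∃[ w ] (w ≡ x ⊎ w ≡ y ⊎ w ≡ z) × Avoids w
  one-of-three-avoids {x} {y} {z} x≢y x≢z y≢z with avoids? x | avoids? y | avoids? z
  ... | inj₁ ax | _ | _ = x , inj₁ refl , ax
  ... | inj₂ _ | inj₁ ay | _ = y , inj₂ (inj₁ refl) , ay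
  ... | inj₂ _ | inj₂ _ | inj₁ az = z , inj₂ (inj₂ refl) , az
  ... | inj₂ (inj₁ refl) | inj₂ (inj₁ refl) | _ = ⊥-elim (x≢y refl)
  ... | inj₂ (inj₂ refl) | inj₂ (inj₂ refl) | _ = ⊥-elim (x≢y refl)
  ... | inj₂ (inj₁ refl) | inj₂ (inj₂ refl) | inj₂ (inj₁ refl) = ⊥-elim (x≢z refl)
  ... | inj₂ (inj₁ refl) | inj₂ (inj₂ refl) | inj₂ (inj₂ refl) = ⊥-elim (y≢z refl)
  ... | inj₂ (inj₂ refl) | inj₂ (inj₁ refl) | inj₂ (inj₁ refl) = ⊥-elim (y≢z refl)
  ... | inj₂ (inj₂ refl) | inj₂ (inj₁ refl) | inj₂ (inj₂ refl) = ⊥-elim (x≢z refl)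

  unique-avoid-two : ∀ {xs} → Unique xs → 3 ≤ length xs → ∃[ w ] w ∈ xs × Avoids w
  unique-avoid-two {[]} _ ()
  unique-avoid-two {_ ∷ []} _ (s≤s ())
  unique-avoid-two {_ ∷ _ ∷ []} _ (s≤s (s≤s ()))
  unique-avoid-two {x ∷ y ∷ z ∷ _} ((x≢y ∷ x≢z ∷ _) ∷ (y≢z ∷ _) ∷ _) _
    with one-of-three-avoids x≢y x≢z y≢z
  ... | w , inj₁ refl , aw = w , here refl , aw
  ... | w , inj₂ (inj₁ refl) , aw = w , there (here refl) , aw
  ... | w , inj₂ (inj₂ refl) , aw = w , there (there (here refl)) , aw

neighbour-avoiding : ∀ {n} (G : Graph n) {v} → 3 ≤ deg G v → (a b : Fin n) →
                     ∃[ w ] Adj G v w × w ≢ a × w ≢ b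
neighbour-avoiding {n} G {v} δ≥3 a b
  with unique-avoid-two Fin._≟_ a b {filterᵇ (adj G v) (allFin n)} (Unique.filter⁺ (T? ∘ adj G v) (Unique.allFin⁺ n)) δ≥3
... | w , w∈ , w≢a , w≢b = w , proj₂ (∈-filter⁻ (T? ∘ adj G v) {xs = allFin n} w∈) , w≢a , w≢b

module _ {m : ℕ} .{{_ : ℕ.NonZero m}} where

  [a%m+b]%m≡[a+b]%m : ∀ a b → (a % m + b) % m ≡ (a + b) % m
  [a%m+b]%m≡[a+b]%m a b = begin
    (a % m + b) % m          ≡⟨ %-distribˡ-+ (a % m) b m ⟩
    (a % m % m + b % m) % m  ≡⟨ cong (λ z → (z + b % m) % m) (m%n%n≡m%n a m) ⟩
    (a % m + b % m) % m      ≡⟨ sym (%-distribˡ-+ a b m) ⟩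
    (a + b) % m              ∎
    where open ≡-Reasoning

  [a+b%m]%m≡[a+b]%m : ∀ a b → (a + b % m) % m ≡ (a + b) % m
  [a+b%m]%m≡[a+b]%m a b = trans (cong (_% m) (+-comm a (b % m))) (trans ([a%m+b]%m≡[a+b]%m b a) (cong (_% m) (+-comm b a)))

  suc[m%n]%n≡suc[m]%n : ∀ a → suc (a % m) % m ≡ suc a % m
  suc[m%n]%n≡suc[m]%n = [a+b%m]%m≡[a+b]%m 1

  [t+r]%m≡t⇒r≡0 : ∀ {t r} → t < m → r < m → (t + r) % m ≡ t → r ≡ 0
  [t+r]%m≡t⇒r≡0 {t} {r} t<m r<m eq with t + r ℕ.<? m
  ... | yes t+r<m = +-cancelˡ-≡ t r 0 (trans (trans (sym (m<n⇒m%n≡m t+r<m)) eq) (sym (+-identityʳ t)))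
  ... | no t+r≮m = ⊥-elim (<-irrefl r≡m r<m)
    where
    m≤t+r : m ≤ t + r
    m≤t+r = ≮⇒≥ t+r≮m
    t+r∸m≡t : t + r ∸ m ≡ t
    t+r∸m≡t = trans (sym (m<n⇒m%n≡m (m<n+o⇒m∸n<o (t + r) m (+-mono-< t<m r<m))))
                    (trans (m≤n⇒[n∸m]%m≡n%m m≤t+r) eq)
    r≡m : r ≡ m
    r≡m = +-cancelˡ-≡ t r m (trans (sym (m∸n+n≡m m≤t+r)) (cong (_+ m) t+r∸m≡t))

  private
    cancel-≤ : ∀ s {p q} → p ≤ q → q < m → (p + s) % m ≡ (q + s) % m → p ≡ q
    cancel-≤ s {p} {q} p≤q q<m eq = trans (sym (+-identityʳ p)) (trans (cong (p +_) (sym r≡0)) (m+[n∸m]≡n p≤q))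
      where
      r = q ∸ p
      shift : ((p + s) % m + r) % m ≡ (p + s) % m
      shift = begin
        ((p + s) % m + r) % m  ≡⟨ [a%m+b]%m≡[a+b]%m (p + s) r ⟩
        (p + s + r) % m        ≡⟨ cong (_% m) (trans (+-assoc p s r) (cong (p +_) (+-comm s r))) ⟩
        (p + (r + s)) % m      ≡⟨ cong (_% m) (sym (+-assoc p r s)) ⟩
        (p + r + s) % m        ≡⟨ cong (λ z → (z + s) % m) (m+[n∸m]≡n p≤q) ⟩
        (q + s) % m            ≡⟨ sym eq ⟩
        (p + s) % m            ∎
        where open ≡-Reasoning
      r≡0 : r ≡ 0
      r≡0 = [t+r]%m≡t⇒r≡0 (m%n<n (p + s) m) (≤-<-trans (m∸n≤m q p) q<m) shift

  [p+s]%m≡[q+s]%m⇒p≡q : ∀ s {p q} → p < m → q < m → (p + s) % m ≡ (q + s) % m → p ≡ q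
  [p+s]%m≡[q+s]%m⇒p≡q s {p} {q} p<m q<m eq with ≤-total p q
  ... | inj₁ p≤q = cancel-≤ s p≤q q<m eq
  ... | inj₂ q≤p = sym (cancel-≤ s q≤p p<m (sym eq))

CyclicSucc : ℕ → ℕ → ℕ → Set
CyclicSucc L a b = suc a ≡ b ⊎ (suc a ≡ L × b ≡ 0)

toℕ-nxt : ∀ {k} (i : Fin (suc k)) → toℕ (nxt i) ≡ suc (toℕ i) % suc k
toℕ-nxt i = toℕ-fromℕ< _

nxt⇔CyclicSucc : ∀ {L} (i j : Fin L) → j ≡ nxt i ⇔ CyclicSucc L (toℕ i) (toℕ j)
nxt⇔CyclicSucc {suc k} i j = mk⇔ ⇒ ⇐
  where
  wrap : suc (toℕ i) ≡ suc k → toℕ (nxt i) ≡ 0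
  wrap last = trans (toℕ-nxt i) (trans (cong (_% suc k) last) (n%n≡0 (suc k)))
  ⇒ : j ≡ nxt i → CyclicSucc (suc k) (toℕ i) (toℕ j)
  ⇒ refl with suc (toℕ i) ℕ.<? suc k
  ... | yes i+1<L = inj₁ (sym (trans (toℕ-nxt i) (m<n⇒m%n≡m i+1<L)))
  ... | no i+1≮L = inj₂ (last , wrap last)
    where last = ≤-antisym (toℕ<n i) (≮⇒≥ i+1≮L)
  ⇐ : CyclicSucc (suc k) (toℕ i) (toℕ j) → j ≡ nxt i
  ⇐ (inj₁ i+1≡j) = toℕ-injective (trans (sym i+1≡j)
    (sym (trans (toℕ-nxt i) (m<n⇒m%n≡m (subst (_< suc k) (sym i+1≡j) (toℕ<n j))))))
  ⇐ (inj₂ (last , j≡0)) = toℕ-injective (trans j≡0 (sym (wrap last)))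

nxt-prv : ∀ {L} (i : Fin L) → nxt (prv i) ≡ i
nxt-prv {suc k} i = toℕ-injective (begin
  toℕ (nxt (prv i))                  ≡⟨ toℕ-nxt (prv i) ⟩
  suc (toℕ (prv i)) % suc k          ≡⟨ cong (λ z → suc z % suc k) (toℕ-fromℕ< _) ⟩
  suc ((toℕ i + k) % suc k) % suc k  ≡⟨ suc[m%n]%n≡suc[m]%n {suc k} (toℕ i + k) ⟩
  suc (toℕ i + k) % suc k            ≡⟨ cong (_% suc k) (sym (+-suc (toℕ i) k)) ⟩
  (toℕ i + suc k) % suc k            ≡⟨ [m+n]%n≡m%n (toℕ i) (suc k) ⟩
  toℕ i % suc k                      ≡⟨ m<n⇒m%n≡m (toℕ<n i) ⟩
  toℕ i                              ∎)
  where open ≡-Reasoning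

prv-nxt : ∀ {L} (i : Fin L) → prv (nxt i) ≡ i
prv-nxt {suc k} i = toℕ-injective (begin
  toℕ (prv (nxt i))                 ≡⟨ toℕ-fromℕ< _ ⟩
  (toℕ (nxt i) + k) % suc k         ≡⟨ cong (λ z → (z + k) % suc k) (toℕ-nxt i) ⟩
  (suc (toℕ i) % suc k + k) % suc k ≡⟨ [a%m+b]%m≡[a+b]%m {suc k} (suc (toℕ i)) k ⟩
  (suc (toℕ i) + k) % suc k         ≡⟨ cong (_% suc k) (sym (+-suc (toℕ i) k)) ⟩
  (toℕ i + suc k) % suc k           ≡⟨ [m+n]%n≡m%n (toℕ i) (suc k) ⟩
  toℕ i % suc k                     ≡⟨ m<n⇒m%n≡m (toℕ<n i) ⟩
  toℕ i                             ∎)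
  where open ≡-Reasoning

Outside : ∀ {n m} → (Fin m → Fin n) → Fin n → Set
Outside c v = ∀ j → v ≢ c j

module _ {n : ℕ} (G : Graph n) where

  square : ∀ {p q r s} → p ≢ r → q ≢ s →
           Adj G p q → Adj G q r → Adj G r s → Adj G s p → ContainsCycle G 4
  square {p} {q} {r} {s} p≢r q≢s pq qr rs sp = f , injective , edge
    where
    f : Fin 4 → Fin n
    f fz = p
    f (fs fz) = q
    f (fs (fs fz)) = r
    f (fs (fs (fs fz))) = s
    edge : ∀ i → Adj G (f i) (f (nxt i))
    edge fz = pq
    edge (fs fz) = qr
    edge (fs (fs fz)) = rs
    edge (fs (fs (fs fz))) = sp
    diagonal : ∀ i → f i ≢ f (nxt (nxt i))
    diagonal fz = p≢r
    diagonal (fs fz) = q≢s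
    diagonal (fs (fs fz)) = p≢r ∘ sym
    diagonal (fs (fs (fs fz))) = q≢s ∘ sym
    pairs : ∀ i j → i ≡ j ⊎ j ≡ nxt i ⊎ i ≡ nxt j ⊎ j ≡ nxt (nxt i)
    pairs = toWitness {a? = all? λ i → all? λ j →
      (i Fin.≟ j) ⊎-dec (j Fin.≟ nxt i) ⊎-dec (i Fin.≟ nxt j) ⊎-dec (j Fin.≟ nxt (nxt i))} _
    injective : InjectiveF f
    injective i j fi≡fj with pairs i j
    ... | inj₁ i≡j = i≡j
    ... | inj₂ (inj₁ refl) = ⊥-elim (Adj⇒≢ G (edge i) fi≡fj)
    ... | inj₂ (inj₂ (inj₁ refl)) = ⊥-elim (Adj⇒≢ G (edge j) (sym fi≡fj))
    ... | inj₂ (inj₂ (inj₂ refl)) = ⊥-elim (diagonal i fi≡fj)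

  pentagon : ∀ {v₀ v₁ v₂ v₃ v₄} →
             Adj G v₀ v₁ → Adj G v₁ v₂ → Adj G v₂ v₃ → Adj G v₃ v₄ → Adj G v₄ v₀ →
             ¬ Adj G v₀ v₂ → ¬ Adj G v₁ v₃ → ¬ Adj G v₂ v₄ → ¬ Adj G v₃ v₀ → ¬ Adj G v₄ v₁ →
             Σ (Fin 5 → Fin n) (Hole G 5)
  pentagon {v₀} {v₁} {v₂} {v₃} {v₄} e₀ e₁ e₂ e₃ e₄ ¬c₀ ¬c₁ ¬c₂ ¬c₃ ¬c₄ =
    v , s≤s (s≤s (s≤s z≤n)) , injective , λ i j → mk⇔ (adjacent i j) (consecutive i j)
    where
    v : Fin 5 → Fin n
    v fz = v₀
    v (fs fz) = v₁
    v (fs (fs fz)) = v₂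
    v (fs (fs (fs fz))) = v₃
    v (fs (fs (fs (fs fz)))) = v₄
    edge : ∀ i → Adj G (v i) (v (nxt i))
    edge fz = e₀
    edge (fs fz) = e₁
    edge (fs (fs fz)) = e₂
    edge (fs (fs (fs fz))) = e₃
    edge (fs (fs (fs (fs fz)))) = e₄
    chordless : ∀ i → ¬ Adj G (v i) (v (nxt (nxt i)))
    chordless fz = ¬c₀
    chordless (fs fz) = ¬c₁
    chordless (fs (fs fz)) = ¬c₂
    chordless (fs (fs (fs fz))) = ¬c₃
    chordless (fs (fs (fs (fs fz)))) = ¬c₄
    Distance2 : Fin 5 → Fin 5 → Set
    Distance2 i j = j ≡ nxt (nxt i) × i ≡ nxt (nxt (nxt j))
    pairs : ∀ i j → i ≡ j ⊎ j ≡ nxt i ⊎ i ≡ nxt j ⊎ Distance2 i j ⊎ Distance2 j i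
    pairs = toWitness {a? = all? λ i → all? λ j →
      (i Fin.≟ j) ⊎-dec (j Fin.≟ nxt i) ⊎-dec (i Fin.≟ nxt j) ⊎-dec
      ((j Fin.≟ nxt (nxt i)) ×-dec (i Fin.≟ nxt (nxt (nxt j)))) ⊎-dec
      ((i Fin.≟ nxt (nxt j)) ×-dec (j Fin.≟ nxt (nxt (nxt i))))} _
    distinct-at-distance-2 : ∀ {i j} → Distance2 i j → v i ≢ v j
    distinct-at-distance-2 {j = j} (_ , refl) vi≡vj =
      chordless j (Adj-sym G (subst (Adj G (v (nxt (nxt j)))) vi≡vj (edge (nxt (nxt j)))))
    injective : InjectiveF v
    injective i j vi≡vj with pairs i j
    ... | inj₁ i≡j = i≡j
    ... | inj₂ (inj₁ refl) = ⊥-elim (Adj⇒≢ G (edge i) vi≡vj)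
    ... | inj₂ (inj₂ (inj₁ refl)) = ⊥-elim (Adj⇒≢ G (edge j) (sym vi≡vj))
    ... | inj₂ (inj₂ (inj₂ (inj₁ d))) = ⊥-elim (distinct-at-distance-2 d vi≡vj)
    ... | inj₂ (inj₂ (inj₂ (inj₂ d))) = ⊥-elim (distinct-at-distance-2 d (sym vi≡vj))
    adjacent : ∀ i j → Adj G (v i) (v j) → j ≡ nxt i ⊎ i ≡ nxt j
    adjacent i j vij with pairs i j
    ... | inj₁ refl = ⊥-elim (Adj-irrefl G vij)
    ... | inj₂ (inj₁ j≡i⁺) = inj₁ j≡i⁺
    ... | inj₂ (inj₂ (inj₁ i≡j⁺)) = inj₂ i≡j⁺
    ... | inj₂ (inj₂ (inj₂ (inj₁ (refl , _)))) = ⊥-elim (chordless i vij)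
    ... | inj₂ (inj₂ (inj₂ (inj₂ (refl , _)))) = ⊥-elim (chordless j (Adj-sym G vij))
    consecutive : ∀ i j → j ≡ nxt i ⊎ i ≡ nxt j → Adj G (v i) (v j)
    consecutive i _ (inj₁ refl) = edge i
    consecutive _ j (inj₂ refl) = Adj-sym G (edge j)

  sequence-hole : (L : ℕ) (f : ℕ → Fin n) → 3 ≤ L →
    (∀ {a b} → a < L → b < L → f a ≡ f b → a ≡ b) →
    (∀ {a b} → a < L → b < L → Adj G (f a) (f b) → CyclicSucc L a b ⊎ CyclicSucc L b a) →
    (∀ {a b} → a < L → b < L → CyclicSucc L a b → Adj G (f a) (f b)) →
    Hole G L (f ∘ toℕ)
  sequence-hole L f 3≤L injective adjacent consecutive =
    3≤L , (λ i j eq → toℕ-injective (injective (toℕ<n i) (toℕ<n j) eq)) , λ i j → mk⇔ (⇒ i j) (⇐ i j)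
    where
    ⇒ : ∀ i j → Adj G (f (toℕ i)) (f (toℕ j)) → j ≡ nxt i ⊎ i ≡ nxt j
    ⇒ i j fij with adjacent (toℕ<n i) (toℕ<n j) fij
    ... | inj₁ succ = inj₁ (from (nxt⇔CyclicSucc i j) succ)
    ... | inj₂ succ = inj₂ (from (nxt⇔CyclicSucc j i) succ)
    ⇐ : ∀ i j → j ≡ nxt i ⊎ i ≡ nxt j → Adj G (f (toℕ i)) (f (toℕ j))
    ⇐ i j (inj₁ eq) = consecutive (toℕ<n i) (toℕ<n j) (to (nxt⇔CyclicSucc i j) eq)
    ⇐ i j (inj₂ eq) = Adj-sym G (consecutive (toℕ<n j) (toℕ<n i) (to (nxt⇔CyclicSucc j i) eq))

module _ {n m : ℕ} (G : Graph n) (c : Fin m → Fin n) where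

  Anchor : (Fin m → Set) → Set
  Anchor X = ∃[ u ] Outside c u × (∀ j → Adj G u (c j) ⇔ X j)

  Pendant : Fin n → Set
  Pendant u = ∃[ w ] Outside c w × Adj G u w × (∀ j → ¬ Adj G w (c j))

  AnchoredEdge : (Fin m → Set) → Set
  AnchoredEdge X = Σ (Anchor X) (Pendant ∘ proj₁)

  anchor-resp : ∀ {X Y} → (∀ j → X j ⇔ Y j) → Anchor X → Anchor Y
  anchor-resp X⇔Y (u , out , u-X) = u , out , λ j → ⇔-trans (u-X j) (X⇔Y j)

  anchored-edge-resp : ∀ {X Y} → (∀ j → X j ⇔ Y j) → AnchoredEdge X → AnchoredEdge Y
  anchored-edge-resp X⇔Y ((u , out , u-X) , pendant) = anchor-resp X⇔Y (u , out , u-X) , pendant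

  anchor-path : ∀ {X} → Anchor X → Σ (Fin 1 → Fin n) (GoodPath G c X 1)
  anchor-path {X} (u , out , u-X) = (λ _ → u) , (λ { fz fz _ → refl }) , (λ _ → out) , adjacent , attached
    where
    adjacent : ∀ a b → Adj G u u ⇔ (toℕ b ≡ suc (toℕ a) ⊎ toℕ a ≡ suc (toℕ b))
    adjacent fz fz = mk⇔ (⊥-elim ∘ Adj-irrefl G) λ { (inj₁ ()) ; (inj₂ ()) }
    attached : ∀ a j → Adj G u (c j) ⇔ (toℕ a ≡ 0 × X j)
    attached fz j = mk⇔ (λ u-cj → refl , to (u-X j) u-cj) (from (u-X j) ∘ proj₂)

  anchored-edge-path : ∀ {X} → AnchoredEdge X → Σ (Fin 2 → Fin n) (GoodPath G c X 2)
  anchored-edge-path {X} ((u , out-u , u-X) , w , out-w , uw , ¬w-c) = path , injective , outside , adjacent , attached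
    where
    path : Fin 2 → Fin n
    path fz = u
    path (fs _) = w
    injective : InjectiveF path
    injective fz fz _ = refl
    injective fz (fs fz) u≡w = ⊥-elim (Adj⇒≢ G uw u≡w)
    injective (fs fz) fz w≡u = ⊥-elim (Adj⇒≢ G uw (sym w≡u))
    injective (fs fz) (fs fz) _ = refl
    outside : ∀ a j → path a ≢ c j
    outside fz = out-u
    outside (fs fz) = out-w
    adjacent : ∀ a b → Adj G (path a) (path b) ⇔ (toℕ b ≡ suc (toℕ a) ⊎ toℕ a ≡ suc (toℕ b))
    adjacent fz fz = mk⇔ (⊥-elim ∘ Adj-irrefl G) λ { (inj₁ ()) ; (inj₂ ()) }
    adjacent fz (fs fz) = mk⇔ (λ _ → inj₁ refl) (λ _ → uw)
    adjacent (fs fz) fz = mk⇔ (λ _ → inj₂ refl) (λ _ → Adj-sym G uw)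
    adjacent (fs fz) (fs fz) = mk⇔ (⊥-elim ∘ Adj-irrefl G) λ { (inj₁ ()) ; (inj₂ ()) }
    attached : ∀ a j → Adj G (path a) (c j) ⇔ (toℕ a ≡ 0 × X j)
    attached fz j = mk⇔ (λ u-cj → refl , to (u-X j) u-cj) (from (u-X j) ∘ proj₂)
    attached (fs fz) j = mk⇔ (⊥-elim ∘ ¬w-c j) λ { (() , _) }

  outside⇒∉ : ∀ {v} → Outside c v → T (not (onCᵇ c v))
  outside⇒∉ {v} out = T-not⁺ λ v∈ → let (j , cj==v) = any-allFin⁻ (λ j → c j == v) v∈ in out j (sym (==⇒≡ cj==v))

  ∉⇒outside : ∀ {v} → T (not (onCᵇ c v)) → Outside c v
  ∉⇒outside {v} v∉ j v≡cj = T-not⁻ v∉ (any-allFin⁺ (λ j → c j == v) j (≡⇒== (sym v≡cj)))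

  inI⁻ : ∀ {j} → T (inIᵇ G c j) → ∃[ v ] Outside c v × Adj G v (c j) × Adj G v (c (nxt j))
  inI⁻ j∈I with any-allFin⁻ _ j∈I
  ... | v , t with to T-∧ t
  ...   | v∉ , t′ with to T-∧ t′
  ...     | v-cj , v-cj⁺ = v , ∉⇒outside v∉ , v-cj , v-cj⁺

  inI⁺ : ∀ {j v} → Outside c v → Adj G v (c j) → Adj G v (c (nxt j)) → T (inIᵇ G c j)
  inI⁺ {v = v} out v-cj v-cj⁺ = any-allFin⁺ _ v (from T-∧ (outside⇒∉ out , from T-∧ (v-cj , v-cj⁺)))

  InX-I : ∀ {i} → T (inIᵇ G c i) → ∀ j → (j ≡ i ⊎ j ≡ nxt i) ⇔ InX G c i j
  InX-I i∈I _ = if-true i∈I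

  InX-I⁺ : ∀ {i} → ¬ T (inIᵇ G c i) → T (inIᵇ G c (prv i)) → ∀ j → (j ≡ prv i ⊎ j ≡ nxt (prv i)) ⇔ InX G c i j
  InX-I⁺ {i} i∉I i⁻∈I j = ⇔-trans (subst (λ z → (j ≡ prv i ⊎ j ≡ nxt (prv i)) ⇔ (j ≡ prv i ⊎ j ≡ z)) (nxt-prv i) (mk⇔ id id))
                                  (⇔-trans (if-true i⁻∈I) (if-false i∉I))

  InX-lone : ∀ {i} → ¬ T (inIᵇ G c i) → ¬ T (inIᵇ G c (prv i)) → ∀ j → j ≡ i ⇔ InX G c i j
  InX-lone i∉I i⁻∉I _ = ⇔-trans (if-false i⁻∉I) (if-false i∉I)

m<2+n⇒m≤n⊎m≡1+n : ∀ {a g} → a < 2 + g → a ≤ g ⊎ a ≡ suc g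
m<2+n⇒m≤n⊎m≡1+n a<2+g with m≤n⇒m<n∨m≡n (s≤s⁻¹ a<2+g)
... | inj₁ a<1+g = inj₁ (s≤s⁻¹ a<1+g)
... | inj₂ a≡1+g = inj₂ a≡1+g

m<3+n⇒m≤n⊎m≡1+n⊎m≡2+n : ∀ {a g} → a < 3 + g → a ≤ g ⊎ a ≡ suc g ⊎ a ≡ suc (suc g)
m<3+n⇒m≤n⊎m≡1+n⊎m≡2+n a<3+g with m≤n⇒m<n∨m≡n (s≤s⁻¹ a<3+g)
... | inj₁ a<2+g = Data.Sum.map₂ inj₁ (m<2+n⇒m≤n⊎m≡1+n a<2+g)
... | inj₂ a≡2+g = inj₂ (inj₂ a≡2+g)

3+m<1+n⇒m<n : ∀ {a k} → 3 + a < suc k → a < k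
3+m<1+n⇒m<n {a} 3+a<1+k = ≤-trans (m≤n+m (suc a) 2) (s≤s⁻¹ 3+a<1+k)

antipodal-arithmetic : ∀ {k a d L} → 5 ≤ k → a + d ≡ L → L ≤ suc k → suc k ≤ 3 + a → suc k ≤ 3 + d →
                     k ≡ 5 × a ≡ 3 × L ≡ 6
antipodal-arithmetic {k} {a} {d} {L} 5≤k a+d≡L L≤1+k 1+k≤3+a 1+k≤3+d with k≡5
  where
  k≡5 : k ≡ 5
  k≡5 = ≤-antisym (s≤s⁻¹ (+-cancelʳ-≤ (suc k) (suc k) 6 (begin
    suc k + suc k        ≤⟨ +-mono-≤ 1+k≤3+a 1+k≤3+d ⟩
    (3 + a) + (3 + d)    ≡⟨ cong (3 +_) (trans (+-comm a (3 + d)) (cong (3 +_) (+-comm d a))) ⟩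
    6 + (a + d)          ≡⟨ cong (6 +_) a+d≡L ⟩
    6 + L                ≤⟨ +-monoʳ-≤ 6 L≤1+k ⟩
    6 + suc k            ∎))) 5≤k
    where open ≤-Reasoning
... | refl = refl , a≡3 , trans (sym a+d≡L) (cong₂ _+_ a≡3 d≡3)
  where
  a+d≤6 : a + d ≤ 6
  a+d≤6 = subst (_≤ 6) (sym a+d≡L) L≤1+k
  a≡3 : a ≡ 3
  a≡3 = ≤-antisym (+-cancelʳ-≤ 3 a 3 (≤-trans (+-monoʳ-≤ a (+-cancelˡ-≤ 3 3 d 1+k≤3+d)) a+d≤6))
                  (+-cancelˡ-≤ 3 3 a 1+k≤3+a)
  d≡3 : d ≡ 3
  d≡3 = ≤-antisym (+-cancelˡ-≤ 3 d 3 (≤-trans (+-monoˡ-≤ d (+-cancelˡ-≤ 3 3 a 1+k≤3+a)) a+d≤6))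
                  (+-cancelˡ-≤ 3 3 d 1+k≤3+d)

-- Hole vertices are addressed by naturals read modulo m = suc k; an offset a from a base s is
-- written a + s, so that suc a + s is definitionally suc (a + s).
module OnHole {n} (G : Graph n) {k : ℕ} (c : Fin (suc k) → Fin n) (hole : Hole G (suc k) c) where

  m : ℕ
  m = suc k

  pos : ℕ → Fin m
  pos a = fromℕ< (m%n<n a m)

  x : ℕ → Fin n
  x = c ∘ pos

  2<m : 2 < m
  2<m = proj₁ hole

  c-injective : InjectiveF c
  c-injective = proj₁ (proj₂ hole)

  pos⇒% : ∀ {a b} → pos a ≡ pos b → a % m ≡ b % m
  pos⇒% pa≡pb = trans (sym (toℕ-fromℕ< _)) (trans (cong toℕ pa≡pb) (toℕ-fromℕ< _))

  pos-toℕ : ∀ j → pos (toℕ j) ≡ j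
  pos-toℕ j = toℕ-injective (trans (toℕ-fromℕ< _) (m<n⇒m%n≡m (toℕ<n j)))

  nxt-pos : ∀ a → nxt (pos a) ≡ pos (suc a)
  nxt-pos a = toℕ-injective (trans (toℕ-nxt (pos a)) (trans (cong (λ z → suc z % m) (toℕ-fromℕ< _))
                                    (trans (suc[m%n]%n≡suc[m]%n {m} a) (sym (toℕ-fromℕ< _)))))

  x-cong : ∀ {a b} → a % m ≡ b % m → x a ≡ x b
  x-cong a≡b = cong c (toℕ-injective (trans (toℕ-fromℕ< _) (trans a≡b (sym (toℕ-fromℕ< _)))))

  x-injective : ∀ {a b} → x a ≡ x b → a % m ≡ b % m
  x-injective {a} {b} xa≡xb = pos⇒% {a} {b} (c-injective _ _ xa≡xb)

  x-toℕ : ∀ j → x (toℕ j) ≡ c j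
  x-toℕ j = cong c (pos-toℕ j)

  x-prv : ∀ j → x (k + toℕ j) ≡ c (prv j)
  x-prv j = x-cong {k + toℕ j} {toℕ j + k} (cong (_% m) (+-comm k (toℕ j)))

  x-m+ : ∀ a → x (m + a) ≡ x a
  x-m+ a = x-cong {m + a} {a} (trans (cong (_% m) (+-comm m a)) ([m+n]%n≡m%n a m))

  x-adj-suc : ∀ a → Adj G (x a) (x (suc a))
  x-adj-suc a = from (proj₂ (proj₂ hole) _ _) (inj₁ (sym (nxt-pos a)))

  x-adj⇒ : ∀ {a b} → Adj G (x a) (x b) → suc a % m ≡ b % m ⊎ suc b % m ≡ a % m
  x-adj⇒ {a} {b} xab with to (proj₂ (proj₂ hole) _ _) xab
  ... | inj₁ b⁺ = inj₁ (pos⇒% {suc a} {b} (sym (trans b⁺ (nxt-pos a))))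
  ... | inj₂ a⁺ = inj₂ (pos⇒% {suc b} {a} (sym (trans a⁺ (nxt-pos b))))

  offset-injective : ∀ s {a b} → a < m → b < m → x (a + s) ≡ x (b + s) → a ≡ b
  offset-injective s {a} {b} a<m b<m eq = [p+s]%m≡[q+s]%m⇒p≡q s a<m b<m (x-injective {a + s} {b + s} eq)

  offset-succ : ∀ s {a b} → a < m → b < m → (suc a + s) % m ≡ (b + s) % m → CyclicSucc m a b
  offset-succ s a<m b<m eq with m≤n⇒m<n∨m≡n a<m
  ... | inj₁ a+1<m = inj₁ ([p+s]%m≡[q+s]%m⇒p≡q s a+1<m b<m eq)
  ... | inj₂ refl = inj₂ (refl , sym ([p+s]%m≡[q+s]%m⇒p≡q s (s≤s z≤n) b<m
                                    (trans (sym (x-injective {m + s} {s} (x-m+ s))) eq)))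

  offset-adj⇒ : ∀ s {a b} → a < m → b < m → Adj G (x (a + s)) (x (b + s)) →
                CyclicSucc m a b ⊎ CyclicSucc m b a
  offset-adj⇒ s {a} {b} a<m b<m xab with x-adj⇒ {a + s} {b + s} xab
  ... | inj₁ eq = inj₁ (offset-succ s a<m b<m eq)
  ... | inj₂ eq = inj₂ (offset-succ s b<m a<m eq)

  offset-of : ∀ s b → ∃[ a ] a < m × x b ≡ x (a + s)
  offset-of s b = a , m%n<n (b + r) m , x-cong {b} {a + s} (sym shifted)
    where
    r = m ∸ s % m
    a = (b + r) % m
    shifted : (a + s) % m ≡ b % m
    shifted = begin
      ((b + r) % m + s) % m  ≡⟨ [a%m+b]%m≡[a+b]%m (b + r) s ⟩
      (b + r + s) % m        ≡⟨ sym ([a+b%m]%m≡[a+b]%m (b + r) s) ⟩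
      (b + r + s % m) % m    ≡⟨ cong (_% m) (+-assoc b r (s % m)) ⟩
      (b + (r + s % m)) % m  ≡⟨ cong (λ z → (b + z) % m) (m∸n+n≡m (m%n≤n s m)) ⟩
      (b + m) % m            ≡⟨ [m+n]%n≡m%n b m ⟩
      b % m                  ∎
      where open ≡-Reasoning

  index-offset : ∀ s l → ∃[ a ] a < m × c l ≡ x (a + s)
  index-offset s l with offset-of s (toℕ l)
  ... | a , a<m , eq = a , a<m , trans (sym (x-toℕ l)) eq

  private
    splice : ℕ → ℕ → (ℕ → Fin n) → ℕ → Fin n
    splice s g t a with a ℕ.≤? g
    ... | yes _ = x (a + s)
    ... | no _ = t (a ∸ suc g)

    splice-arc : ∀ {s g t a} → a ≤ g → splice s g t a ≡ x (a + s)
    splice-arc {g = g} {a = a} a≤g with a ℕ.≤? g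
    ... | yes _ = refl
    ... | no a≰g = ⊥-elim (a≰g a≤g)

    splice-tail₀ : ∀ {s g t} → splice s g t (suc g) ≡ t 0
    splice-tail₀ {g = g} {t} with suc g ℕ.≤? g
    ... | yes g<g = ⊥-elim (<-irrefl refl g<g)
    ... | no _ = cong t (n∸n≡0 g)

    splice-tail₁ : ∀ {s g t} → splice s g t (suc (suc g)) ≡ t 1
    splice-tail₁ {g = g} {t} with suc (suc g) ℕ.≤? g
    ... | yes g+1<g = ⊥-elim (<-irrefl refl (≤-trans (n≤1+n (suc g)) g+1<g))
    ... | no _ = cong t (m+n∸n≡m 1 g)

    arc-succ : ∀ {g a b} → g < k → a ≤ g → CyclicSucc m a b → suc a ≡ b
    arc-succ g<k a≤g (inj₁ a+1≡b) = a+1≡b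
    arc-succ g<k a≤g (inj₂ (a+1≡m , _)) = ⊥-elim (<-irrefl a+1≡m (s≤s (≤-<-trans a≤g g<k)))

    arc-adj⇒ : ∀ {s g a b} → g < k → a ≤ g → b ≤ g → Adj G (x (a + s)) (x (b + s)) → suc a ≡ b ⊎ suc b ≡ a
    arc-adj⇒ {s} g<k a≤g b≤g xab with offset-adj⇒ s (s≤s (≤-trans a≤g (<⇒≤ g<k))) (s≤s (≤-trans b≤g (<⇒≤ g<k))) xab
    ... | inj₁ succ = inj₁ (arc-succ g<k a≤g succ)
    ... | inj₂ succ = inj₂ (arc-succ g<k b≤g succ)

    arc-injective : ∀ {s g a b} → g < k → a ≤ g → b ≤ g → x (a + s) ≡ x (b + s) → a ≡ b
    arc-injective {s} g<k a≤g b≤g = offset-injective s (s≤s (≤-trans a≤g (<⇒≤ g<k))) (s≤s (≤-trans b≤g (<⇒≤ g<k)))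

  arc-vertex-hole : ∀ s g {v} → 1 ≤ g → g < k → Outside c v → Adj G v (x s) → Adj G v (x (g + s)) →
    (∀ {a} → 0 < a → a < g → ¬ Adj G v (x (a + s))) → Σ (Fin (2 + g) → Fin n) (Hole G (2 + g))
  arc-vertex-hole s g {v} 1≤g g<k out v-x₀ v-x_g gap =
    _ , sequence-hole G (2 + g) f (s≤s (s≤s 1≤g)) injective adjacent consecutive
    where
    f = splice s g (λ _ → v)
    f-arc : ∀ {a} → a ≤ g → f a ≡ x (a + s)
    f-arc = splice-arc {s} {g} {λ _ → v}
    f-end : f (suc g) ≡ v
    f-end = splice-tail₀ {s} {g} {λ _ → v}
    v-end : ∀ {a} → a ≤ g → Adj G v (x (a + s)) → a ≡ 0 ⊎ a ≡ g
    v-end {zero} _ _ = inj₁ refl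
    v-end {suc a} a≤g va with m≤n⇒m<n∨m≡n a≤g
    ... | inj₁ a<g = ⊥-elim (gap (s≤s z≤n) a<g va)
    ... | inj₂ a≡g = inj₂ a≡g
    injective : ∀ {a b} → a < 2 + g → b < 2 + g → f a ≡ f b → a ≡ b
    injective a< b< eq with m<2+n⇒m≤n⊎m≡1+n a< | m<2+n⇒m≤n⊎m≡1+n b<
    ... | inj₁ a≤g | inj₁ b≤g = arc-injective {s} g<k a≤g b≤g (trans (sym (f-arc a≤g)) (trans eq (f-arc b≤g)))
    ... | inj₁ a≤g | inj₂ refl = ⊥-elim (out _ (trans (sym f-end) (trans (sym eq) (f-arc a≤g))))
    ... | inj₂ refl | inj₁ b≤g = ⊥-elim (out _ (trans (sym f-end) (trans eq (f-arc b≤g))))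
    ... | inj₂ refl | inj₂ refl = refl
    adjacent : ∀ {a b} → a < 2 + g → b < 2 + g → Adj G (f a) (f b) →
               CyclicSucc (2 + g) a b ⊎ CyclicSucc (2 + g) b a
    adjacent a< b< fab with m<2+n⇒m≤n⊎m≡1+n a< | m<2+n⇒m≤n⊎m≡1+n b<
    ... | inj₁ a≤g | inj₁ b≤g = Data.Sum.map inj₁ inj₁
                                  (arc-adj⇒ {s} g<k a≤g b≤g (subst₂ (Adj G) (f-arc a≤g) (f-arc b≤g) fab))
    ... | inj₁ a≤g | inj₂ refl with v-end a≤g (Adj-sym G (subst₂ (Adj G) (f-arc a≤g) f-end fab))
    ...   | inj₁ refl = inj₂ (inj₂ (refl , refl))
    ...   | inj₂ refl = inj₁ (inj₁ refl)
    adjacent a< b< fab | inj₂ refl | inj₁ b≤g with v-end b≤g (subst₂ (Adj G) f-end (f-arc b≤g) fab)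
    ...   | inj₁ refl = inj₁ (inj₂ (refl , refl))
    ...   | inj₂ refl = inj₂ (inj₁ refl)
    adjacent a< b< fab | inj₂ refl | inj₂ refl = ⊥-elim (Adj-irrefl G fab)
    consecutive : ∀ {a b} → a < 2 + g → b < 2 + g → CyclicSucc (2 + g) a b → Adj G (f a) (f b)
    consecutive {a} a< b< (inj₁ refl) with m<2+n⇒m≤n⊎m≡1+n b<
    ... | inj₁ b≤g = subst₂ (Adj G) (sym (f-arc (<⇒≤ b≤g))) (sym (f-arc b≤g)) (x-adj-suc (a + s))
    ... | inj₂ refl = subst₂ (Adj G) (sym (f-arc ≤-refl)) (sym f-end) (Adj-sym G v-x_g)
    consecutive a< b< (inj₂ (refl , refl)) = subst₂ (Adj G) (sym f-end) (sym (f-arc z≤n)) v-x₀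

  arc-edge-hole : ∀ s g {p q} → g < k → Outside c p → Outside c q → Adj G p q →
    Adj G p (x (g + s)) → Adj G q (x s) →
    (∀ {a} → a < g → ¬ Adj G p (x (a + s))) → (∀ {a} → 0 < a → a ≤ g → ¬ Adj G q (x (a + s))) →
    Σ (Fin (3 + g) → Fin n) (Hole G (3 + g))
  arc-edge-hole s g {p} {q} g<k out-p out-q pq p-x_g q-x₀ p-gap q-gap =
    _ , sequence-hole G (3 + g) f (s≤s (s≤s (s≤s z≤n))) injective adjacent consecutive
    where
    tail : ℕ → Fin n
    tail zero = p
    tail (suc _) = q
    f = splice s g tail
    f-arc : ∀ {a} → a ≤ g → f a ≡ x (a + s)
    f-arc = splice-arc {s} {g} {tail}
    f-p : f (suc g) ≡ p
    f-p = splice-tail₀ {s} {g} {tail}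
    f-q : f (suc (suc g)) ≡ q
    f-q = splice-tail₁ {s} {g} {tail}
    p-end : ∀ {a} → a ≤ g → Adj G p (x (a + s)) → a ≡ g
    p-end a≤g pa with m≤n⇒m<n∨m≡n a≤g
    ... | inj₁ a<g = ⊥-elim (p-gap a<g pa)
    ... | inj₂ a≡g = a≡g
    q-end : ∀ {a} → a ≤ g → Adj G q (x (a + s)) → a ≡ 0
    q-end {zero} _ _ = refl
    q-end {suc a} a≤g qa = ⊥-elim (q-gap (s≤s z≤n) a≤g qa)
    out-arc : ∀ {v a} → Outside c v → a ≤ g → f a ≢ v
    out-arc out a≤g eq = out _ (trans (sym eq) (f-arc a≤g))
    injective : ∀ {a b} → a < 3 + g → b < 3 + g → f a ≡ f b → a ≡ b
    injective a< b< eq with m<3+n⇒m≤n⊎m≡1+n⊎m≡2+n a< | m<3+n⇒m≤n⊎m≡1+n⊎m≡2+n b<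
    ... | inj₁ a≤g | inj₁ b≤g = arc-injective {s} g<k a≤g b≤g (trans (sym (f-arc a≤g)) (trans eq (f-arc b≤g)))
    ... | inj₁ a≤g | inj₂ (inj₁ refl) = ⊥-elim (out-arc out-p a≤g (trans eq f-p))
    ... | inj₁ a≤g | inj₂ (inj₂ refl) = ⊥-elim (out-arc out-q a≤g (trans eq f-q))
    ... | inj₂ (inj₁ refl) | inj₁ b≤g = ⊥-elim (out-arc out-p b≤g (trans (sym eq) f-p))
    ... | inj₂ (inj₂ refl) | inj₁ b≤g = ⊥-elim (out-arc out-q b≤g (trans (sym eq) f-q))
    ... | inj₂ (inj₁ refl) | inj₂ (inj₁ refl) = refl
    ... | inj₂ (inj₂ refl) | inj₂ (inj₂ refl) = refl
    ... | inj₂ (inj₁ refl) | inj₂ (inj₂ refl) = ⊥-elim (Adj⇒≢ G pq (trans (sym f-p) (trans eq f-q)))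
    ... | inj₂ (inj₂ refl) | inj₂ (inj₁ refl) = ⊥-elim (Adj⇒≢ G pq (trans (sym f-p) (trans (sym eq) f-q)))
    adjacent : ∀ {a b} → a < 3 + g → b < 3 + g → Adj G (f a) (f b) →
               CyclicSucc (3 + g) a b ⊎ CyclicSucc (3 + g) b a
    adjacent a< b< fab with m<3+n⇒m≤n⊎m≡1+n⊎m≡2+n a< | m<3+n⇒m≤n⊎m≡1+n⊎m≡2+n b<
    ... | inj₁ a≤g | inj₁ b≤g = Data.Sum.map inj₁ inj₁
                                  (arc-adj⇒ {s} g<k a≤g b≤g (subst₂ (Adj G) (f-arc a≤g) (f-arc b≤g) fab))
    ... | inj₁ a≤g | inj₂ (inj₁ refl) with p-end a≤g (Adj-sym G (subst₂ (Adj G) (f-arc a≤g) f-p fab))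
    ...   | refl = inj₁ (inj₁ refl)
    adjacent a< b< fab | inj₁ a≤g | inj₂ (inj₂ refl) with q-end a≤g (Adj-sym G (subst₂ (Adj G) (f-arc a≤g) f-q fab))
    ...   | refl = inj₂ (inj₂ (refl , refl))
    adjacent a< b< fab | inj₂ (inj₁ refl) | inj₁ b≤g with p-end b≤g (subst₂ (Adj G) f-p (f-arc b≤g) fab)
    ...   | refl = inj₂ (inj₁ refl)
    adjacent a< b< fab | inj₂ (inj₂ refl) | inj₁ b≤g with q-end b≤g (subst₂ (Adj G) f-q (f-arc b≤g) fab)
    ...   | refl = inj₁ (inj₂ (refl , refl))
    adjacent a< b< fab | inj₂ (inj₁ refl) | inj₂ (inj₁ refl) = ⊥-elim (Adj-irrefl G fab)
    adjacent a< b< fab | inj₂ (inj₂ refl) | inj₂ (inj₂ refl) = ⊥-elim (Adj-irrefl G fab)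
    adjacent a< b< fab | inj₂ (inj₁ refl) | inj₂ (inj₂ refl) = inj₁ (inj₁ refl)
    adjacent a< b< fab | inj₂ (inj₂ refl) | inj₂ (inj₁ refl) = inj₂ (inj₁ refl)
    consecutive : ∀ {a b} → a < 3 + g → b < 3 + g → CyclicSucc (3 + g) a b → Adj G (f a) (f b)
    consecutive {a} a< b< (inj₁ refl) with m<3+n⇒m≤n⊎m≡1+n⊎m≡2+n b<
    ... | inj₁ b≤g = subst₂ (Adj G) (sym (f-arc (<⇒≤ b≤g))) (sym (f-arc b≤g)) (x-adj-suc (a + s))
    ... | inj₂ (inj₁ refl) = subst₂ (Adj G) (sym (f-arc ≤-refl)) (sym f-p) (Adj-sym G p-x_g)
    ... | inj₂ (inj₂ refl) = subst₂ (Adj G) (sym f-p) (sym f-q) pq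
    consecutive a< b< (inj₂ (refl , refl)) = subst₂ (Adj G) (sym f-q) (sym (f-arc z≤n)) q-x₀

  module C4Free (noC4 : ¬ ContainsCycle G 4) where

    two-apart : ∀ {v} t → Outside c v → Adj G v (x t) → ¬ Adj G v (x (2 + t))
    two-apart {v} t out v-xt v-xt₂ =
      noC4 (square G (out _) xt≢xt₂ v-xt (x-adj-suc t) (x-adj-suc (suc t)) (Adj-sym G v-xt₂))
      where
      xt≢xt₂ : x t ≢ x (2 + t)
      xt≢xt₂ eq with offset-injective t {0} {2} (≤-trans (s≤s z≤n) 2<m) 2<m eq
      ... | ()

    across-edge : ∀ {v w} t → Outside c v → Outside c w → Adj G v w → Adj G v (x t) → ¬ Adj G w (x (suc t))
    across-edge t out-v out-w vw v-xt w-xt₁ =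
      noC4 (square G (out-v _) (λ eq → out-w _ (sym eq)) v-xt (x-adj-suc t) (Adj-sym G w-xt₁) (Adj-sym G vw))

    module Shortest (shortest : ∀ L (c′ : Fin L → Fin n) → Hole G L c′ → 5 ≤ L → ¬ L < m) where

      no-short-hole : ∀ {L} → 5 ≤ L → L < m → ¬ Σ (Fin L → Fin n) (Hole G L)
      no-short-hole 5≤L L<m (c′ , h) = shortest _ c′ h 5≤L L<m

      -- An outside neighbour of x_s with a neighbour x_{s+a}, 2 ≤ a < k, would close a hole
      -- of length in [5, m) through the last hole neighbour before x_{s+a}, or a C₄.
      no-far-neighbour : ∀ {v} s → Outside c v → Adj G v (x s) → ∀ a → 2 ≤ a → a < k → ¬ Adj G v (x (a + s))
      no-far-neighbour {v} s out v-x₀ = <-rec _ step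
        where
        step : ∀ a → (∀ {b} → b < a → 2 ≤ b → b < k → ¬ Adj G v (x (b + s))) →
               2 ≤ a → a < k → ¬ Adj G v (x (a + s))
        step zero _ ()
        step (suc zero) _ (s≤s ())
        step (suc (suc zero)) _ _ _ v-xa = two-apart s out v-x₀ v-xa
        step (suc (suc (suc g))) below _ a<k v-xa with Adj? G v (x (suc s))
        step (suc (suc (suc zero))) _ _ _ v-x₃ | yes v-x₁ = two-apart (suc s) out v-x₁ v-x₃
        step (suc (suc (suc (suc g)))) below _ a<k v-xa | yes v-x₁ =
          no-short-hole (s≤s (s≤s (s≤s (s≤s (s≤s z≤n))))) (s≤s a<k)
            (arc-vertex-hole (suc s) (3 + g) (s≤s z≤n) (<-trans (n<1+n _) a<k) out v-x₁
              (subst (Adj G v ∘ x) (sym (+-suc (3 + g) s)) v-xa) gap)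
          where
          gap : ∀ {b} → 0 < b → b < 3 + g → ¬ Adj G v (x (b + suc s))
          gap {b} 0<b b< v-xb = below (s≤s b<) (s≤s 0<b) (<-trans (s≤s b<) a<k)
            (subst (Adj G v ∘ x) (+-suc b s) v-xb)
        step (suc (suc (suc g))) below _ a<k v-xa | no ¬v-x₁ with m≤n⇒m<n∨m≡n a<k
        ...   | inj₁ a+1<k = no-short-hole (s≤s (s≤s (s≤s (s≤s (s≤s z≤n))))) (s≤s a+1<k)
                  (arc-vertex-hole s (3 + g) (s≤s z≤n) (<-trans (n<1+n _) a+1<k) out v-x₀ v-xa gap)
          where
          gap : ∀ {b} → 0 < b → b < 3 + g → ¬ Adj G v (x (b + s))
          gap {suc zero} _ _ = ¬v-x₁
          gap {suc (suc b)} _ b< = below b< (s≤s (s≤s z≤n)) (<-trans b< a<k)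
        ...   | inj₂ refl = two-apart (3 + g + s) out v-xa (subst (Adj G v) (sym (x-m+ s)) v-x₀)

      neighbour-offsets : ∀ {v} s → Outside c v → Adj G v (x s) → ∀ b → Adj G v (x b) →
                          x b ≡ x s ⊎ x b ≡ x (suc s) ⊎ x b ≡ x (k + s)
      neighbour-offsets {v} s out v-x₀ b v-xb with offset-of s b
      ... | zero , _ , eq = inj₁ eq
      ... | suc zero , _ , eq = inj₂ (inj₁ eq)
      ... | suc (suc a) , a<m , eq with m≤n⇒m<n∨m≡n (s≤s⁻¹ a<m)
      ...   | inj₂ refl = inj₂ (inj₂ eq)
      ...   | inj₁ a<k = ⊥-elim (no-far-neighbour s out v-x₀ (suc (suc a)) (s≤s (s≤s z≤n)) a<k (subst (Adj G v) eq v-xb))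

      not-both-sides : ∀ {v} s → Outside c v → Adj G v (x (suc s)) → ¬ Adj G v (x (k + s))
      not-both-sides {v} s out v-x₁ v-xk =
        two-apart (k + s) out v-xk (subst (Adj G v) (sym (trans (cong x (sym (+-suc m s))) (x-m+ (suc s)))) v-x₁)

      hole-neighbours : ∀ {v j l} → Outside c v → Adj G v (c j) → Adj G v (c l) → l ≡ j ⊎ l ≡ nxt j ⊎ l ≡ prv j
      hole-neighbours {v} {j} {l} out v-cj v-cl
        with neighbour-offsets (toℕ j) out (subst (Adj G v) (sym (x-toℕ j)) v-cj)
                               (toℕ l) (subst (Adj G v) (sym (x-toℕ l)) v-cl)
      ... | inj₁ eq = inj₁ (c-injective l j (trans (sym (x-toℕ l)) (trans eq (x-toℕ j))))
      ... | inj₂ (inj₁ eq) = inj₂ (inj₁ (c-injective l (nxt j) (trans (sym (x-toℕ l)) eq)))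
      ... | inj₂ (inj₂ eq) = inj₂ (inj₂ (c-injective l (prv j) (trans (sym (x-toℕ l)) (trans eq (x-prv j)))))

      not-next-and-previous : ∀ {v j} → Outside c v → Adj G v (c (nxt j)) → ¬ Adj G v (c (prv j))
      not-next-and-previous {v} {j} out v-cj⁺ v-cj⁻ =
        not-both-sides (toℕ j) out v-cj⁺ (subst (Adj G v) (sym (x-prv j)) v-cj⁻)

      -- If w has a hole neighbour x_{t+a}, the first and the last of them close, with the edge yw and
      -- the two ends of the arc, holes of lengths a + 3 and (L - a) + 3; both must be at least m.
      module Attached (5≤k : 5 ≤ k) {y w : Fin n} (t L : ℕ) (k≤L : k ≤ L) (L≤m : L ≤ m)
        (out-y : Outside c y) (out-w : Outside c w) (yw : Adj G y w)
        (y-x₀ : Adj G y (x t)) (y-x_L : Adj G y (x (L + t)))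
        (y-gap : ∀ {a} → 0 < a → a < L → ¬ Adj G y (x (a + t)))
        (¬w-x₀ : ¬ Adj G w (x t)) (¬w-x_L : ¬ Adj G w (x (L + t))) where

        private
          5≤3+ : ∀ a → 5 ≤ 3 + suc (suc a)
          5≤3+ a = s≤s (s≤s (s≤s (s≤s (s≤s z≤n))))

        no-near-start : ∀ a → 0 < a → a < L → 3 + a < m → ¬ Adj G w (x (a + t))
        no-near-start = <-rec _ step
          where
          step : ∀ a → (∀ {b} → b < a → 0 < b → b < L → 3 + b < m → ¬ Adj G w (x (b + t))) →
                 0 < a → a < L → 3 + a < m → ¬ Adj G w (x (a + t))
          step (suc zero) _ _ _ _ = across-edge t out-y out-w yw y-x₀
          step (suc (suc a)) below _ a<L 3+a<m w-xa =
            no-short-hole (5≤3+ a) 3+a<m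
              (arc-edge-hole t (2 + a) (3+m<1+n⇒m<n 3+a<m) out-w out-y (Adj-sym G yw) w-xa y-x₀ w-gap
                 (λ 0<b b≤ → y-gap 0<b (≤-<-trans b≤ a<L)))
            where
            w-gap : ∀ {b} → b < 2 + a → ¬ Adj G w (x (b + t))
            w-gap {zero} _ = ¬w-x₀
            w-gap {suc b} b< = below b< (s≤s z≤n) (<-trans b< a<L) (<-trans (+-monoʳ-< 3 b<) 3+a<m)

        no-near-end : ∀ d b → d + b ≡ L → 0 < d → 3 + d < m → ¬ Adj G w (x (b + t))
        no-near-end = <-rec _ step
          where
          step : ∀ d → (∀ {d′} → d′ < d → ∀ b → d′ + b ≡ L → 0 < d′ → 3 + d′ < m → ¬ Adj G w (x (b + t))) →
                 ∀ b → d + b ≡ L → 0 < d → 3 + d < m → ¬ Adj G w (x (b + t))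
          step (suc zero) _ b 1+b≡L _ _ w-xb =
            across-edge (b + t) out-w out-y (Adj-sym G yw) w-xb (subst (λ z → Adj G y (x (z + t))) (sym 1+b≡L) y-x_L)
          step (suc (suc d)) below b D+b≡L _ 3+D<m w-xb =
            no-short-hole (5≤3+ d) 3+D<m
              (arc-edge-hole (b + t) D (3+m<1+n⇒m<n 3+D<m) out-y out-w yw
                 (subst (Adj G y) (x-at-end D+b≡L) y-x_L) w-xb y-gap′ w-gap)
            where
            D = 2 + d
            x-at-end : ∀ {a} → a + b ≡ L → x (L + t) ≡ x (a + (b + t))
            x-at-end {a} a+b≡L = cong x (trans (cong (_+ t) (sym a+b≡L)) (+-assoc a b t))
            positive : ∀ {b} → D + b ≡ L → 0 < b
            positive {suc _} _ = s≤s z≤n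
            positive {zero} D+0≡L = ⊥-elim (<-irrefl refl (≤-trans (m≤n+m (suc D) 2)
              (≤-trans (s≤s⁻¹ 3+D<m) (≤-trans k≤L (≤-reflexive (trans (sym D+0≡L) (+-identityʳ D)))))))
            0<b : 0 < b
            0<b = positive D+b≡L
            y-gap′ : ∀ {a} → a < D → ¬ Adj G y (x (a + (b + t)))
            y-gap′ {a} a<D y-xa = y-gap (≤-trans 0<b (m≤n+m b a)) (subst (a + b <_) D+b≡L (+-monoˡ-< b a<D))
              (subst (Adj G y ∘ x) (sym (+-assoc a b t)) y-xa)
            w-gap : ∀ {a} → 0 < a → a ≤ D → ¬ Adj G w (x (a + (b + t)))
            w-gap {a} 0<a a≤D w-xa with m≤n⇒m<n∨m≡n a≤D
            ... | inj₂ refl = ¬w-x_L (subst (Adj G w) (sym (x-at-end D+b≡L)) w-xa)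
            ... | inj₁ a<D = below (∸-monoʳ-< 0<a a≤D) (a + b) rest+a+b≡L (m<n⇒0<n∸m a<D)
                  (≤-<-trans (+-monoʳ-≤ 3 (m∸n≤m D a)) 3+D<m) (subst (Adj G w ∘ x) (sym (+-assoc a b t)) w-xa)
              where
              rest+a+b≡L : D ∸ a + (a + b) ≡ L
              rest+a+b≡L = trans (sym (+-assoc (D ∸ a) a b)) (trans (cong (_+ b) (m∸n+n≡m (<⇒≤ a<D))) D+b≡L)

        antipodal-only : ∀ {a} → 0 < a → a < L → Adj G w (x (a + t)) → k ≡ 5 × a ≡ 3 × L ≡ 6
        antipodal-only {a} 0<a a<L w-xa =
          antipodal-arithmetic 5≤k (m+[n∸m]≡n (<⇒≤ a<L)) L≤m
            (≮⇒≥ λ 3+a<m → no-near-start a 0<a a<L 3+a<m w-xa)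
            (≮⇒≥ λ 3+d<m → no-near-end (L ∸ a) a (m∸n+n≡m (<⇒≤ a<L)) (m<n⇒0<n∸m a<L) 3+d<m w-xa)

module Analysis {n} (G : Graph n) (δ≥3 : ∀ v → 3 ≤ deg G v) (noC4 : ¬ ContainsCycle G 4)
                {k} (c : Fin (suc k) → Fin n) (hole : Hole G (suc k) c)
                (shortest : ∀ L (c′ : Fin L → Fin n) → Hole G L c′ → 5 ≤ L → ¬ L < suc k) where

  open OnHole G c hole
  open C4Free noC4
  open Shortest shortest

  common-neighbour-exact : ∀ {v j} → Outside c v → Adj G v (c j) → Adj G v (c (nxt j)) →
                           ∀ l → Adj G v (c l) ⇔ (l ≡ j ⊎ l ≡ nxt j)
  common-neighbour-exact {v} {j} out v-cj v-cj⁺ l = mk⇔ ⇒ ⇐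
    where
    ⇒ : Adj G v (c l) → l ≡ j ⊎ l ≡ nxt j
    ⇒ v-cl with hole-neighbours out v-cj v-cl
    ... | inj₁ l≡j = inj₁ l≡j
    ... | inj₂ (inj₁ l≡j⁺) = inj₂ l≡j⁺
    ... | inj₂ (inj₂ refl) = ⊥-elim (not-next-and-previous out v-cj⁺ v-cl)
    ⇐ : l ≡ j ⊎ l ≡ nxt j → Adj G v (c l)
    ⇐ (inj₁ refl) = v-cj
    ⇐ (inj₂ refl) = v-cj⁺

  common-neighbour-anchor : ∀ {j} → T (inIᵇ G c j) → Anchor G c (λ l → l ≡ j ⊎ l ≡ nxt j)
  common-neighbour-anchor j∈I with inI⁻ G c j∈I
  ... | v , out , v-cj , v-cj⁺ = v , out , common-neighbour-exact out v-cj v-cj⁺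

  common-neighbour-anchored-edge : 5 ≤ k → ∀ {j} → T (inIᵇ G c j) → AnchoredEdge G c (λ l → l ≡ j ⊎ l ≡ nxt j)
  common-neighbour-anchored-edge 5≤k {j} j∈I with inI⁻ G c j∈I
  ... | v , out , v-cj , v-cj⁺ with neighbour-avoiding G (δ≥3 v) (c j) (c (nxt j))
  ...   | w , vw , w≢cj , w≢cj⁺ = (v , out , exact) , w , out-w , vw , no-hole-neighbour
    where
    s = toℕ j
    exact = common-neighbour-exact out v-cj v-cj⁺
    out-w : Outside c w
    out-w l refl with to (exact l) vw
    ... | inj₁ refl = w≢cj refl
    ... | inj₂ refl = w≢cj⁺ refl
    v-x₀ : Adj G v (x s)
    v-x₀ = subst (Adj G v) (sym (x-toℕ j)) v-cj
    x-k+1+s : x (k + suc s) ≡ x s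
    x-k+1+s = trans (cong x (+-suc k s)) (x-m+ s)
    ¬w-x₁ : ¬ Adj G w (x (suc s))
    ¬w-x₁ = across-edge s out out-w vw v-x₀
    ¬w-x_k : ¬ Adj G w (x (k + suc s))
    ¬w-x_k w-x = across-edge s out-w out (Adj-sym G vw) (subst (Adj G w) x-k+1+s w-x) v-cj⁺
    v-gap : ∀ {a} → 0 < a → a < k → ¬ Adj G v (x (a + suc s))
    v-gap {a} 0<a a<k v-xa with to (exact (pos (a + suc s))) v-xa
    ... | inj₁ eq = 1+n≢0 (offset-injective s {suc a} {0} (s≤s a<k) (s≤s z≤n)
                      (trans (cong x (sym (+-suc a s))) (trans (cong c eq) (sym (x-toℕ j)))))
    ... | inj₂ eq = <-irrefl (sym (suc-injective (offset-injective s {suc a} {1} (s≤s a<k) (<-trans (n<1+n 1) 2<m)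
                      (trans (cong x (sym (+-suc a s))) (cong c eq))))) 0<a
    open Attached 5≤k (suc s) k ≤-refl (n≤1+n k) out out-w vw v-cj⁺ (subst (Adj G v) (sym x-k+1+s) v-x₀)
                  v-gap ¬w-x₁ ¬w-x_k
    no-hole-neighbour : ∀ l → ¬ Adj G w (c l)
    no-hole-neighbour l w-cl with index-offset (suc s) l
    ... | zero , _ , eq = ¬w-x₁ (subst (Adj G w) eq w-cl)
    ... | suc a , a<m , eq with m≤n⇒m<n∨m≡n (s≤s⁻¹ a<m)
    ...   | inj₂ refl = ¬w-x_k (subst (Adj G w) eq w-cl)
    ...   | inj₁ a<k with antipodal-only (s≤s z≤n) a<k (subst (Adj G w) eq w-cl)
    ...     | refl , _ , ()

  module Lone (i : Fin m) (i∉I : ¬ T (inIᵇ G c i)) (i⁻∉I : ¬ T (inIᵇ G c (prv i))) where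

    s : ℕ
    s = toℕ i

    lonely : ∀ {y} → Outside c y → Adj G y (c i) → ∀ l → Adj G y (c l) → l ≡ i
    lonely {y} out y-ci l y-cl with hole-neighbours out y-ci y-cl
    ... | inj₁ l≡i = l≡i
    ... | inj₂ (inj₁ refl) = ⊥-elim (i∉I (inI⁺ G c out y-ci y-cl))
    ... | inj₂ (inj₂ refl) = ⊥-elim (i⁻∉I (inI⁺ G c out y-cl (subst (Adj G y ∘ c) (sym (nxt-prv i)) y-ci)))

    lonely-exact : ∀ {y} → Outside c y → Adj G y (c i) → ∀ l → Adj G y (c l) ⇔ l ≡ i
    lonely-exact out y-ci l = mk⇔ (lonely out y-ci l) λ { refl → y-ci }

    lonely-outside : ∀ {y w} → Outside c y → Adj G y (c i) → Adj G y w → w ≢ c i → Outside c w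
    lonely-outside out y-ci yw w≢ci l refl = w≢ci (cong c (lonely out y-ci l yw))

    lone-anchor : Anchor G c (_≡ i)
    lone-anchor with neighbour-avoiding G (δ≥3 (c i)) (c (nxt i)) (c (prv i))
    ... | u , ci-u , u≢ci⁺ , u≢ci⁻ = u , out , lonely-exact out (Adj-sym G ci-u)
      where
      out : Outside c u
      out l refl with to (proj₂ (proj₂ hole) i l) ci-u
      ... | inj₁ refl = u≢ci⁺ refl
      ... | inj₂ refl = u≢ci⁻ (cong c (sym (prv-nxt l)))

    x₀≡ci : x s ≡ c i
    x₀≡ci = x-toℕ i

    anchored-edge-or-antipodal : 5 ≤ k → ∀ {y w} → Outside c y → Adj G y (c i) → Adj G y w → w ≢ c i →
                                 ¬ Adj G w (c i) → AnchoredEdge G c (_≡ i) ⊎ (k ≡ 5 × Adj G w (x (3 + s)))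
    anchored-edge-or-antipodal 5≤k {y} {w} out-y y-ci yw w≢ci ¬w-ci with any? (λ l → Adj? G w (c l))
    ... | no none = inj₁ ((y , out-y , lonely-exact out-y y-ci) , w , lonely-outside out-y y-ci yw w≢ci , yw ,
                          λ l w-cl → none (l , w-cl))
    ... | yes (l , w-cl) with index-offset s l
    ...   | zero , _ , eq = ⊥-elim (¬w-ci (subst (Adj G w) (trans eq x₀≡ci) w-cl))
    ...   | suc a , a<m , eq with antipodal-only (s≤s z≤n) a<m (subst (Adj G w) eq w-cl)
      where
      y-x₀ : Adj G y (x s)
      y-x₀ = subst (Adj G y) (sym x₀≡ci) y-ci
      y-gap : ∀ {a} → 0 < a → a < m → ¬ Adj G y (x (a + s))
      y-gap {a} 0<a a<m y-xa = <-irrefl (sym (offset-injective s {a} {0} a<m (s≤s z≤n)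
        (trans (cong c (lonely out-y y-ci (pos (a + s)) y-xa)) (sym x₀≡ci)))) 0<a
      ¬w-x₀ : ¬ Adj G w (x s)
      ¬w-x₀ = ¬w-ci ∘ subst (Adj G w) x₀≡ci
      open Attached 5≤k s m (n≤1+n k) ≤-refl out-y (lonely-outside out-y y-ci yw w≢ci) yw
                    y-x₀ (subst (Adj G y) (sym (x-m+ s)) y-x₀) y-gap ¬w-x₀ (¬w-x₀ ∘ subst (Adj G w) (x-m+ s))
    ...     | k≡5 , refl , _ = inj₂ (k≡5 , subst (Adj G w) eq w-cl)

    lonely-not-antipodal : 5 ≤ k → ∀ {y} → Outside c y → Adj G y (c i) → ¬ Adj G y (x (3 + s))
    lonely-not-antipodal 5≤k out-y y-ci y-x₃ with offset-injective s {3} {0} 3<m (s≤s z≤n)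
                                                   (trans (cong c (lonely out-y y-ci _ y-x₃)) (sym x₀≡ci))
      where 3<m = ≤-trans (m≤n+m 4 2) (s≤s 5≤k)
    ... | ()

    module _ (5≤k : 5 ≤ k) {u : Fin n} (out-u : Outside c u) (u-ci : Adj G u (c i)) where

      -- u has a neighbour y at x_s and a neighbour w at the antipode x_{s+3}; a further neighbour z of y
      -- either gives the anchored edge yz, or closes the pentagon u w x_{s+3} z y.
      reroute : k ≡ 5 → ∀ {y w} → Adj G u y → Adj G y (c i) → Adj G u w → w ≢ c i → ¬ Adj G w (c i) →
                Adj G w (x (3 + s)) → AnchoredEdge G c (_≡ i)
      reroute k≡5 {y} {w} uy y-ci uw w≢ci ¬w-ci w-x₃ with neighbour-avoiding G (δ≥3 y) (c i) u
      ... | z , yz , z≢ci , z≢u with anchored-edge-or-antipodal 5≤k out-y y-ci yz z≢ci ¬z-ci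
        where
        out-y = lonely-outside out-u u-ci uy (Adj⇒≢ G y-ci)
        ¬z-ci : ¬ Adj G z (c i)
        ¬z-ci z-ci = noC4 (square G (Adj⇒≢ G y-ci) z≢u yz z-ci (Adj-sym G u-ci) uy)
      ... | inj₁ edge = edge
      ... | inj₂ (_ , z-x₃) = ⊥-elim (no-short-hole ≤-refl 5<m
            (pentagon G uw w-x₃ (Adj-sym G z-x₃) (Adj-sym G yz) (Adj-sym G uy)
               (lonely-not-antipodal 5≤k out-u u-ci) ¬w-z (lonely-not-antipodal 5≤k out-y y-ci ∘ Adj-sym G) ¬z-u ¬y-w))
        where
        out-y = lonely-outside out-u u-ci uy (Adj⇒≢ G y-ci)
        5<m : 5 < m
        5<m = s≤s (≤-reflexive (sym k≡5))
        ¬y-w : ¬ Adj G y w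
        ¬y-w yw = noC4 (square G w≢ci (λ y≡u → Adj⇒≢ G uy (sym y≡u)) (Adj-sym G yw) y-ci (Adj-sym G u-ci) uw)
        ¬w-z : ¬ Adj G w z
        ¬w-z wz = noC4 (square G (λ w≡y → ¬w-ci (subst (λ v → Adj G v (c i)) (sym w≡y) y-ci)) z≢u
                                 wz (Adj-sym G yz) (Adj-sym G uy) uw)
        ¬z-u : ¬ Adj G z u
        ¬z-u zu = noC4 (square G (out-u _) (λ w≡z → ¬y-w (subst (Adj G y) (sym w≡z) yz)) uw w-x₃ (Adj-sym G z-x₃) zu)

      via-neighbour-at-x₀ : ∀ {y w} → Adj G u y → Adj G y (c i) → Adj G u w → w ≢ c i → ¬ Adj G w (c i) →
                            AnchoredEdge G c (_≡ i)
      via-neighbour-at-x₀ uy y-ci uw w≢ci ¬w-ci with anchored-edge-or-antipodal 5≤k out-u u-ci uw w≢ci ¬w-ci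
      ... | inj₁ edge = edge
      ... | inj₂ (k≡5 , w-x₃) = reroute k≡5 uy y-ci uw w≢ci ¬w-ci w-x₃

      anchored-edge-from-two : ∀ {w₁ w₂} → Adj G u w₁ → Adj G u w₂ → w₁ ≢ c i → w₂ ≢ c i → w₁ ≢ w₂ →
                               AnchoredEdge G c (_≡ i)
      anchored-edge-from-two uw₁ uw₂ w₁≢ci w₂≢ci w₁≢w₂ with Adj? G _ (c i) | Adj? G _ (c i)
      ... | yes w₁-ci | yes w₂-ci = ⊥-elim (noC4 (square G (out-u i) w₁≢w₂ uw₁ w₁-ci (Adj-sym G w₂-ci) (Adj-sym G uw₂)))
      ... | yes w₁-ci | no ¬w₂-ci = via-neighbour-at-x₀ uw₁ w₁-ci uw₂ w₂≢ci ¬w₂-ci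
      ... | no ¬w₁-ci | yes w₂-ci = via-neighbour-at-x₀ uw₂ w₂-ci uw₁ w₁≢ci ¬w₁-ci
      ... | no ¬w₁-ci | no ¬w₂-ci
          with anchored-edge-or-antipodal 5≤k out-u u-ci uw₁ w₁≢ci ¬w₁-ci
             | anchored-edge-or-antipodal 5≤k out-u u-ci uw₂ w₂≢ci ¬w₂-ci
      ...   | inj₁ edge | _ = edge
      ...   | inj₂ _ | inj₁ edge = edge
      ...   | inj₂ (_ , w₁-x₃) | inj₂ (_ , w₂-x₃) =
              ⊥-elim (noC4 (square G (out-u _) w₁≢w₂ uw₁ w₁-x₃ (Adj-sym G w₂-x₃) (Adj-sym G uw₂)))

    lone-anchored-edge : 5 ≤ k → AnchoredEdge G c (_≡ i)
    lone-anchored-edge 5≤k with lone-anchor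
    ... | u , out-u , u-exact with neighbour-avoiding G (δ≥3 u) (c i) (c i)
    ...   | w₁ , uw₁ , w₁≢ci , _ with neighbour-avoiding G (δ≥3 u) (c i) w₁
    ...     | w₂ , uw₂ , w₂≢ci , w₂≢w₁ =
              anchored-edge-from-two 5≤k out-u (from (u-exact i) refl) uw₁ uw₂ w₁≢ci w₂≢ci (w₂≢w₁ ∘ sym)

  anchor : ∀ i → Anchor G c (InX G c i)
  anchor i with T? (inIᵇ G c i) | T? (inIᵇ G c (prv i))
  ... | yes i∈I | _ = anchor-resp G c (InX-I G c i∈I) (common-neighbour-anchor i∈I)
  ... | no i∉I | yes i⁻∈I = anchor-resp G c (InX-I⁺ G c i∉I i⁻∈I) (common-neighbour-anchor i⁻∈I)
  ... | no i∉I | no i⁻∉I = anchor-resp G c (InX-lone G c i∉I i⁻∉I) (Lone.lone-anchor i i∉I i⁻∉I)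

  anchored-edge : 5 ≤ k → ∀ i → AnchoredEdge G c (InX G c i)
  anchored-edge 5≤k i with T? (inIᵇ G c i) | T? (inIᵇ G c (prv i))
  ... | yes i∈I | _ = anchored-edge-resp G c (InX-I G c i∈I) (common-neighbour-anchored-edge 5≤k i∈I)
  ... | no i∉I | yes i⁻∈I = anchored-edge-resp G c (InX-I⁺ G c i∉I i⁻∈I) (common-neighbour-anchored-edge 5≤k i⁻∈I)
  ... | no i∉I | no i⁻∉I = anchored-edge-resp G c (InX-lone G c i∉I i⁻∉I) (Lone.lone-anchored-edge i i∉I i⁻∉I 5≤k)

order-cases : ∀ {k} → 4 ≤ k → k ≡ 4 ⊎ (5 ≤ k × order (suc k) ≡ 2)
order-cases {suc (suc (suc (suc zero)))} _ = inj₁ refl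
order-cases {suc (suc (suc (suc (suc k))))} _ = inj₂ (s≤s (s≤s (s≤s (s≤s (s≤s z≤n)))) , cong (2 +_) (⊓-zeroʳ ⌊ k /2⌋))
order-cases {suc (suc (suc zero))} (s≤s (s≤s (s≤s ())))
order-cases {suc (suc zero)} (s≤s (s≤s ()))
order-cases {suc zero} (s≤s ())
order-cases {zero} ()

lemma2p5 : (n : ℕ) (G : Graph n) →
    (∀ v → 3 ≤ deg G v) →
    ¬ ContainsCycle G 4 → ¬ ContainsCycle G 8 →
    (m : ℕ) (c : Fin m → Fin n) → GoodHole G m c →
    (i : Fin m) →
    Σ (Fin (order m) → Fin n) (GoodPath G c (InX G c i) (order m))
lemma2p5 n G δ≥3 noC4 _ zero c (_ , () , _)
lemma2p5 n G δ≥3 noC4 _ (suc k) c (hole , 5≤m , shortest , _) i with order-cases (s≤s⁻¹ 5≤m)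
... | inj₁ refl = anchor-path G c (Analysis.anchor G δ≥3 noC4 c hole shortest i)
... | inj₂ (5≤k , order≡2) rewrite order≡2 =
      anchored-edge-path G c (Analysis.anchored-edge G δ≥3 noC4 c hole shortest 5≤k i)
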